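{- Let $h \ge 3$ and $v \in V(Q_h)$. If $1 \le i \le h-2$, then $L^v_i \cup L^v_{i+1}$ is not a mutual-visibility set of $Q_h$.
   Context: $Q_h$ is the hypercube with vertex set $\{0,1\}^h$, two strings adjacent iff they differ in exactly one position. For a vertex $v$ and $i \ge 0$, $L^v_i$ is the set of vertices at distance exactly $i$ from $v$. For $M \subseteq V(G)$, a $u,v$-path is $M$-free if it contains no vertex of $M\setminus\{u,v\}$; $u,v$ are $M$-visible if there is an $M$-free shortest $u,v$-path; $M$ is a mutual-visibility set if every two vertices of $M$ are $M$-visible. -}

module Defs where

open import Data.Bool using (Bool)
open import Data.Nat using (ℕ; zero; suc; _<_)
open import Data.Fin using (Fin)
open import Data.Vec using (Vec; lookup)
open import Data.List using (List; []; _∷_)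
open import Data.List.Relation.Unary.All using (All)
open import Data.Product using (Σ; ∃; _×_)
open import Data.Sum using (_⊎_)
open import Relation.Nullary using (¬_)
open import Relation.Binary.PropositionalEquality using (_≡_; _≢_)

-- Vertices of the hypercube Q_h : binary strings of length h
V : ℕ → Set
V h = Vec Bool h

Adj : ∀ {h} → V h → V h → Set
Adj {h} x y = Σ (Fin h) λ i → (lookup x i ≢ lookup y i) × (∀ j → j ≢ i → lookup x j ≡ lookup y j)

data Walk {h : ℕ} : V h → V h → ℕ → Set where
  here : ∀ {u} → Walk u u 0
  step : ∀ {u w z n} → Adj u w → Walk w z n → Walk u z (suc n)

verts : ∀ {h} {u z : V h} {n} → Walk u z n → List (V h)
verts {u = u} here = u ∷ []
verts {u = u} (step _ p) = u ∷ verts p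

Dist : ∀ {h} → V h → V h → ℕ → Set
Dist u z n = Walk u z n × (∀ m → m < n → ¬ Walk u z m)

VSet : ℕ → Set₁
VSet h = V h → Set

_∪_ : ∀ {h} → VSet h → VSet h → VSet h
(A ∪ B) x = A x ⊎ B x

L : ∀ {h} → V h → ℕ → VSet h
L v i w = Dist v w i

Free : ∀ {h} → VSet h → {u z : V h} {n : ℕ} → Walk u z n → Set
Free M {u} {z} p = All (λ w → M w → (w ≡ u) ⊎ (w ≡ z)) (verts p)

Visible : ∀ {h} → VSet h → V h → V h → Set
Visible M u z = ∃ λ n → Dist u z n × Σ (Walk u z n) (λ p → Free M p)

IsMutualVisibility : ∀ {h} → VSet h → Set
IsMutualVisibility M = ∀ x y → M x → M y → Visible M x y

{-# OPTIONS --safe #-}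
module Submission where

-- Distance in Q_h is Hamming distance, so the levels L^v_k of adjacent vertices differ by
-- exactly one. Take x ∈ L^v_i and y ∈ L^v_{i+1} at distance 3, which exists as 1 ≤ i ≤ h-2.
-- Along a shortest path x w₁ w₂ y the level goes from i to i+1 in three ±1 steps, so
-- w₁ ∈ L^v_{i+1} or w₂ ∈ L^v_i: every shortest x,y-path has an inner vertex in the set.

open import Defs
open import Data.Bool using (Bool; true; false; not)
open import Data.Bool.Properties using (not-¬; ¬-not)
open import Data.Fin using (zero; suc)
open import Data.Fin.Properties using (suc-injective)
open import Data.Nat using (ℕ; zero; suc; _+_; _∸_; _≤_; _<_; z≤n; s≤s)
open import Data.Nat.Properties
  using (+-suc; ≤-refl; ≤-trans; ≤-reflexive; ≤-antisym; n≤1+n; ≮⇒≥; <⇒≱; m<m+n; m<n+m; m+n∸n≡m; module ≤-Reasoning)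
open import Data.Vec using ([]; _∷_; lookup)
open import Data.Vec.Relation.Binary.Pointwise.Extensional using (ext; Pointwise-≡⇒≡)
open import Data.List.Relation.Unary.All using (_∷_)
open import Data.Product using (Σ-syntax; _×_; _,_)
open import Data.Sum using (_⊎_; inj₁; inj₂)
open import Data.Empty using (⊥-elim)
open import Function using (_∘_)
open import Relation.Nullary using (¬_)
open import Relation.Binary.PropositionalEquality using (_≡_; _≢_; refl; sym; trans; cong; cong₂; subst)

infix 4 _~_

data _~_ : ℕ → ℕ → Set where
  up   : ∀ {n} → n ~ suc n
  down : ∀ {n} → suc n ~ n

~-+ˡ : ∀ k {m n} → m ~ n → k + m ~ k + n
~-+ˡ k {m}     up   rewrite +-suc k m = up
~-+ˡ k {n = n} down rewrite +-suc k n = down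

~-+ʳ : ∀ k {m n} → m ~ n → m + k ~ n + k
~-+ʳ k up   = up
~-+ʳ k down = down

~⇒≤suc : ∀ {m n} → m ~ n → m ≤ suc n
~⇒≤suc {m} up = ≤-trans (n≤1+n m) (n≤1+n (suc m))
~⇒≤suc down   = ≤-refl

~-three-steps-to-suc : ∀ {i l₁ l₂} → i ~ l₁ → l₁ ~ l₂ → l₂ ~ suc i → l₁ ≡ suc i ⊎ l₂ ≡ i
~-three-steps-to-suc up   _    _  = inj₁ refl
~-three-steps-to-suc down up   _  = inj₂ refl
~-three-steps-to-suc down down ()

bitDiff : Bool → Bool → ℕ
bitDiff true  true  = 0
bitDiff false false = 0
bitDiff _     _     = 1

bitDiff-sym : ∀ a c → bitDiff a c ≡ bitDiff c a
bitDiff-sym true  true  = refl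
bitDiff-sym true  false = refl
bitDiff-sym false true  = refl
bitDiff-sym false false = refl

bitDiff-self : ∀ a → bitDiff a a ≡ 0
bitDiff-self true  = refl
bitDiff-self false = refl

bitDiff-not : ∀ a → bitDiff a (not a) ≡ 1
bitDiff-not true  = refl
bitDiff-not false = refl

bitDiff-~ : ∀ b {a c} → a ≢ c → bitDiff b a ~ bitDiff b c
bitDiff-~ b {c = c} a≢c rewrite ¬-not a≢c = flip b c
  where
  flip : ∀ b c → bitDiff b (not c) ~ bitDiff b c
  flip true  true  = down
  flip true  false = up
  flip false true  = up
  flip false false = down

hamming : ∀ {h} → V h → V h → ℕ
hamming []      []      = 0
hamming (a ∷ u) (c ∷ w) = bitDiff a c + hamming u w

hamming-sym : ∀ {h} (u w : V h) → hamming u w ≡ hamming w u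
hamming-sym []      []      = refl
hamming-sym (a ∷ u) (c ∷ w) = cong₂ _+_ (bitDiff-sym a c) (hamming-sym u w)

hamming-self : ∀ {h} (u : V h) → hamming u u ≡ 0
hamming-self []      = refl
hamming-self (a ∷ u) = cong₂ _+_ (bitDiff-self a) (hamming-self u)

hamming-~-Adj : ∀ {h} (v : V h) {u w : V h} → Adj u w → hamming v u ~ hamming v w
hamming-~-Adj (b ∷ v) {a ∷ u} {c ∷ w} (zero , a≢c , rest)
  with Pointwise-≡⇒≡ {xs = u} {w} (ext λ j → rest (suc j) λ ())
... | refl = ~-+ʳ (hamming v u) (bitDiff-~ b a≢c)
hamming-~-Adj (b ∷ v) {a ∷ u} {c ∷ w} (suc k , uₖ≢wₖ , rest)
  rewrite rest zero (λ ()) =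
  ~-+ˡ (bitDiff b c) (hamming-~-Adj v (k , uₖ≢wₖ , λ j j≢k → rest (suc j) (j≢k ∘ suc-injective)))

Adj-cons : ∀ {h} a {u w : V h} → Adj u w → Adj (a ∷ u) (a ∷ w)
Adj-cons a {u} {w} (k , uₖ≢wₖ , rest) = suc k , uₖ≢wₖ , rest′
  where
  rest′ : ∀ j → j ≢ suc k → lookup (a ∷ u) j ≡ lookup (a ∷ w) j
  rest′ zero    _    = refl
  rest′ (suc j) j≢sk = rest j (j≢sk ∘ cong suc)

Adj-not-head : ∀ {h} a (u : V h) → Adj (a ∷ u) (not a ∷ u)
Adj-not-head a u = zero , not-¬ refl , rest
  where
  rest : ∀ j → j ≢ zero → lookup (a ∷ u) j ≡ lookup (not a ∷ u) j
  rest zero    0≢0 = ⊥-elim (0≢0 refl)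
  rest (suc j) _   = refl

Walk-cons : ∀ {h} a {u w : V h} {n} → Walk u w n → Walk (a ∷ u) (a ∷ w) n
Walk-cons a here       = here
Walk-cons a (step e p) = step (Adj-cons a e) (Walk-cons a p)

hamming≤length : ∀ {h} {u z : V h} {n} → Walk u z n → hamming u z ≤ n
hamming≤length {u = u} here = ≤-reflexive (hamming-self u)
hamming≤length {u = u} {z} {suc n} (step {w = w} u~w p) = begin
  hamming u z        ≡⟨ hamming-sym u z ⟩
  hamming z u        ≤⟨ ~⇒≤suc (hamming-~-Adj z u~w) ⟩
  suc (hamming z w)  ≡⟨ cong suc (hamming-sym z w) ⟩
  suc (hamming w z)  ≤⟨ s≤s (hamming≤length p) ⟩
  suc n              ∎
  where open ≤-Reasoning

hamming-Walk : ∀ {h} (u z : V h) → Walk u z (hamming u z)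
hamming-Walk []          []          = here
hamming-Walk (true ∷ u)  (true ∷ z)  = Walk-cons true (hamming-Walk u z)
hamming-Walk (false ∷ u) (false ∷ z) = Walk-cons false (hamming-Walk u z)
hamming-Walk (true ∷ u)  (false ∷ z) = step (Adj-not-head true u) (Walk-cons false (hamming-Walk u z))
hamming-Walk (false ∷ u) (true ∷ z)  = step (Adj-not-head false u) (Walk-cons true (hamming-Walk u z))

hamming-Dist : ∀ {h} (u z : V h) → Dist u z (hamming u z)
hamming-Dist u z = hamming-Walk u z , λ m m<d p → <⇒≱ m<d (hamming≤length p)

Dist⇒≡hamming : ∀ {h} {u z : V h} {n} → Dist u z n → n ≡ hamming u z
Dist⇒≡hamming {u = u} {z} (p , shortest) =
  ≤-antisym (≮⇒≥ λ d<n → shortest _ d<n (hamming-Walk u z)) (hamming≤length p)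

hamming⇒L : ∀ {h} {v w : V h} {i} → hamming v w ≡ i → L v i w
hamming⇒L {v = v} {w} refl = hamming-Dist v w

inner-vertex-not-endpoint : ∀ {h} {x w y : V h} {a b} → Walk x w (suc a) → Walk w y (suc b) →
  hamming x y ≡ suc a + suc b → ¬ (w ≡ x ⊎ w ≡ y)
inner-vertex-not-endpoint {b = b} _ q d≡ (inj₁ refl) =
  <⇒≱ (subst (suc b <_) (sym d≡) (m<n+m (suc b) (s≤s z≤n))) (hamming≤length q)
inner-vertex-not-endpoint {a = a} p _ d≡ (inj₂ refl) =
  <⇒≱ (subst (suc a <_) (sym d≡) (m<m+n (suc a) (s≤s z≤n))) (hamming≤length p)

module _ {h} {v : V h} {i : ℕ} where

  Lᵢ∪Lᵢ₊₁ : VSet h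
  Lᵢ∪Lᵢ₊₁ = L v i ∪ L v (suc i)

  crossing-Walk-not-Free : ∀ {x y : V h} → hamming v x ≡ i → hamming v y ≡ suc i → hamming x y ≡ 3 →
    (p : Walk x y 3) → ¬ Free Lᵢ∪Lᵢ₊₁ p
  crossing-Walk-not-Free {x} {y} refl hy d≡3
    (step {w = w₁} x~w₁ (step {w = w₂} w₁~w₂ (step w₂~y here))) (_ ∷ free₁ ∷ free₂ ∷ _)
    with ~-three-steps-to-suc (hamming-~-Adj v x~w₁) (hamming-~-Adj v w₁~w₂)
           (subst (hamming v w₂ ~_) hy (hamming-~-Adj v w₂~y))
  ... | inj₁ w₁∈Lᵢ₊₁ = inner-vertex-not-endpoint (step x~w₁ here) (step {w = w₂} w₁~w₂ (step w₂~y here)) d≡3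
                         (free₁ (inj₂ (hamming⇒L w₁∈Lᵢ₊₁)))
  ... | inj₂ w₂∈Lᵢ   = inner-vertex-not-endpoint (step {w = w₁} x~w₁ (step w₁~w₂ here)) (step w₂~y here) d≡3
                         (free₂ (inj₁ (hamming⇒L w₂∈Lᵢ)))

  crossing-pair-not-Visible : ∀ {x y : V h} → hamming v x ≡ i → hamming v y ≡ suc i → hamming x y ≡ 3 →
    ¬ Visible Lᵢ∪Lᵢ₊₁ x y
  crossing-pair-not-Visible hx hy d≡3 (n , d , p , free) with trans (Dist⇒≡hamming d) d≡3
  ... | refl = crossing-Walk-not-Free hx hy d≡3 p free

  crossing-pair-not-MutualVisibility : ∀ {x y : V h} → hamming v x ≡ i → hamming v y ≡ suc i → hamming x y ≡ 3 →
    ¬ IsMutualVisibility Lᵢ∪Lᵢ₊₁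
  crossing-pair-not-MutualVisibility {x} {y} hx hy d≡3 mv =
    crossing-pair-not-Visible hx hy d≡3 (mv x y (inj₁ (hamming⇒L hx)) (inj₂ (hamming⇒L hy)))

flipPrefix : ∀ {n} → ℕ → V n → V n
flipPrefix zero    u       = u
flipPrefix (suc k) []      = []
flipPrefix (suc k) (a ∷ u) = not a ∷ flipPrefix k u

hamming-flipPrefix : ∀ k {n} (u : V n) → k ≤ n → hamming u (flipPrefix k u) ≡ k
hamming-flipPrefix zero    u       _         = hamming-self u
hamming-flipPrefix (suc k) (a ∷ u) (s≤s k≤n) = cong₂ _+_ (bitDiff-not a) (hamming-flipPrefix k u k≤n)

hamming-flipPrefix-flipPrefix : ∀ j k {n} (u : V n) → j ≤ k → k ≤ n →
  hamming (flipPrefix j u) (flipPrefix k u) ≡ k ∸ j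
hamming-flipPrefix-flipPrefix zero    k       u       _         k≤n       = hamming-flipPrefix k u k≤n
hamming-flipPrefix-flipPrefix (suc j) (suc k) (a ∷ u) (s≤s j≤k) (s≤s k≤n) =
  cong₂ _+_ (bitDiff-self (not a)) (hamming-flipPrefix-flipPrefix j k u j≤k k≤n)

crossing-pair : ∀ {n} (v : V (suc n)) j → 2 + j ≤ n →
  Σ[ x ∈ V (suc n) ] Σ[ y ∈ V (suc n) ] hamming v x ≡ suc j × hamming v y ≡ 2 + j × hamming x y ≡ 3
crossing-pair {n} (b ∷ t) j 2+j≤n =
  not b ∷ flipPrefix j t , b ∷ flipPrefix (2 + j) t ,
  cong₂ _+_ (bitDiff-not b) (hamming-flipPrefix j t j≤n) ,
  cong₂ _+_ (bitDiff-self b) (hamming-flipPrefix (2 + j) t 2+j≤n) ,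
  cong₂ _+_ (trans (bitDiff-sym (not b) b) (bitDiff-not b))
            (trans (hamming-flipPrefix-flipPrefix j (2 + j) t j≤2+j 2+j≤n) (m+n∸n≡m 2 j))
  where
  j≤2+j : j ≤ 2 + j
  j≤2+j = ≤-trans (n≤1+n j) (n≤1+n (suc j))
  j≤n : j ≤ n
  j≤n = ≤-trans j≤2+j 2+j≤n

proposition3p2 : (h : ℕ) → 3 ≤ h → (v : V h) → (i : ℕ) → 1 ≤ i → i ≤ h ∸ 2 →
    ¬ IsMutualVisibility (L v i ∪ L v (suc i))
proposition3p2 (suc (suc (suc h))) (s≤s (s≤s (s≤s z≤n))) v (suc j) (s≤s z≤n) (s≤s j≤h)
  with crossing-pair v j (s≤s (s≤s j≤h))
... | x , y , hx , hy , d≡3 = crossing-pair-not-MutualVisibility hx hy d≡3
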